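{- Fix a family $\{F(N)\}_{N\ge0}$ of series in $q$, let $\underline{k}$ be a finite list of nonnegative integers, and write $c^{(r)}$ for $r$ consecutive arguments equal to $c$. Then: (i) For integers $a\ge i\ge 2$ and $m\ge 0$, \[ \mathfrak{S}\big(m^{(a)},(m+1)^{(i)},\underline{k}\big)-\mathfrak{S}\big(m^{(a-1)},(m+1)^{(i)},m,\underline{k}\big) =\mathfrak{S}\big(m^{(i-1)},(m+1)^{(a+1)},\underline{k}\big)-\mathfrak{S}\big(m^{(i-2)},(m+1)^{(a+1)},m,\underline{k}\big). \] (ii) For integers $a\ge i\ge 1$ and $m\ge 0$, \[ \sum_{j=0}^{i-1}\mathfrak{S}\big(m^{(a)},(m+1)^{(j+1)},m^{(i-1-j)},\underline{k}\big)=\sum_{j=0}^{a}\mathfrak{S}\big(m^{(i-1)},(m+1)^{(j+1)},m^{(a-j)},\underline{k}\big). \] In every term the list $\underline{k}$ occupies the arguments from position $a+i+1$ on.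
   Context: For a finite list $(k_1,\ldots,k_b)$ of nonnegative integers, define \[ \mathfrak{S}(k_1,\ldots,k_b)=\sum_{N_1,\ldots, N_b\ge 0}\frac{q^{\sum_{i=1}^b\binom{N_i+k_i}{2}}F(N_b)}{(q;q)_{N_1}}\begin{bmatrix}N_1\\ N_2\end{bmatrix}\begin{bmatrix}N_2\\ N_3\end{bmatrix}\cdots \begin{bmatrix}N_{b-1}\\ N_b\end{bmatrix}, \] so the $i$-th argument $k_i$ is attached to the summation index $N_i$. Here $(q;q)_n=\prod_{j=1}^n(1-q^j)$ and $\begin{bmatrix} N\\ M\end{bmatrix}=\frac{(q;q)_N}{(q;q)_M(q;q)_{N-M}}$ for $0\le M\le N$, $0$ otherwise. -}

module Defs where

open import Data.Nat as ℕ using (ℕ; zero; suc; _∸_; _≤?_; _<?_)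
open import Data.Nat.Combinatorics using (_C_)
open import Data.Nat.Divisibility using (_∣?_)
open import Data.Integer as ℤ using (ℤ; 0ℤ; 1ℤ)
open import Data.List using (List; []; _∷_)
open import Relation.Nullary using (yes; no)

-- Formal power series in q with integer coefficients: n ↦ coefficient of q^n.
PS : Set
PS = ℕ → ℤ

0ₚ : PS
0ₚ _ = 0ℤ

1ₚ : PS
1ₚ zero    = 1ℤ
1ₚ (suc _) = 0ℤ

Σ< : ℕ → (ℕ → ℤ) → ℤ
Σ< zero    f = 0ℤ
Σ< (suc n) f = Σ< n f ℤ.+ f n

_+ₚ_ : PS → PS → PS
(f +ₚ g) n = f n ℤ.+ g n

_-ₚ_ : PS → PS → PS
(f -ₚ g) n = f n ℤ.- g n

_*ₚ_ : PS → PS → PS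
(f *ₚ g) n = Σ< (suc n) (λ i → f i ℤ.* g (n ∸ i))

ΣPS< : ℕ → (ℕ → PS) → PS
ΣPS< n f c = Σ< n (λ j → f j c)

shift : ℕ → PS → PS
shift e f n with n <? e
... | yes _ = 0ℤ
... | no  _ = f (n ∸ e)

-- 1 - q^j
oneMinusQ^ : ℕ → PS
oneMinusQ^ j n with n ℕ.≟ 0 | n ℕ.≟ j
... | yes _ | yes _ = 0ℤ
... | yes _ | no  _ = 1ℤ
... | no  _ | yes _ = ℤ.- 1ℤ
... | no  _ | no  _ = 0ℤ

-- 1/(1 - q^j) = Σ_k q^{jk}, for j ≥ 1
geom : ℕ → PS
geom j n with j ∣? n
... | yes _ = 1ℤ
... | no  _ = 0ℤ

poch : ℕ → PS
poch zero    = 1ₚ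
poch (suc n) = poch n *ₚ oneMinusQ^ (suc n)

invPoch : ℕ → PS
invPoch zero    = 1ₚ
invPoch (suc n) = invPoch n *ₚ geom (suc n)

qbin : ℕ → ℕ → PS
qbin N M with M ≤? N
... | yes _ = (poch N *ₚ invPoch M) *ₚ invPoch (N ∸ M)
... | no  _ = 0ₚ

-- Truncated inner sums: all summation indices range over 0..Mx.
-- inner Mx F prev ks = Σ_{N_{j},...,N_b ≤ Mx} q^{Σ C(N+k,2)} [prev;N_j] ... [N_{b-1};N_b] F(N_b)
inner : ℕ → (ℕ → PS) → ℕ → List ℕ → PS
inner Mx F prev []       = F prev
inner Mx F prev (k ∷ ks) =
  ΣPS< (suc Mx) (λ N → shift ((N ℕ.+ k) C 2) (qbin prev N *ₚ inner Mx F N ks))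

-- Partial sum of 𝔖(k_1,...,k_b) with all N_i ≤ Mx.
-- (For b = 0 the sum is not defined by the paper; we set it to 0. It is never used.)
𝔖≤ : ℕ → (ℕ → PS) → List ℕ → PS
𝔖≤ Mx F []       = 0ₚ
𝔖≤ Mx F (k ∷ ks) =
  ΣPS< (suc Mx) (λ N → shift ((N ℕ.+ k) C 2) (invPoch N *ₚ inner Mx F N ks))

-- Equality of the q-adic limits of two families of partial sums:
-- every coefficient eventually agrees.
_≐_ : (ℕ → PS) → (ℕ → PS) → Set
A ≐ B = ∀ (n : ℕ) → Σ ℕ (λ M₀ → ∀ (M : ℕ) → M₀ ℕ.≤ M → A M n ≡ B M n)
  where open import Data.Product using (Σ)
        open import Relation.Binary.PropositionalEquality using (_≡_)

-- Everything rests on one exchange relation in the q-adic limit,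
--   𝔖(p, c, c+1, r) - 𝔖(p, c+1, c, r) = 𝔖(p+1, c+1, c+1, r),
-- where p+1 raises every entry of the prefix p by one.  It comes from q^C(N+c+1,2) = q^C(N+c,2) q^(N+c)
-- and (1 - q^(N-N′)) [N;N′] = (1 - q^N) [N-1;N′] at the exchanged pair; after the shift N ↦ N + 1 the
-- factor 1 - q^N is absorbed by 1/(q;q)_N or by the q-binomial one level up, and the shift raises every
-- earlier argument by one.
-- Passing an m to the right through a block of (m+1)'s by repeated exchanges writes the left side of (i)
-- as a term symmetric in a and i plus the left side of (ii) at level m + 1, so (ii) at level m + 1 gives
-- (i) at level m.  Conversely, expanding 𝔖(m^(a), (m+1)^(i+1), k) into differences of the shape of (i)
-- reduces (ii) for i + 1 to (ii) for i and to (i) for the pairs (b, i + 1), which come from (ii) for i one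
-- level up.  So an induction on i, for all a, m and k at once, proves (ii) and then (i); neither needs i ≤ a.

module Submission where

open import Defs
open import Data.Nat using (ℕ)

module PowerSeries where

  open import Data.Nat as ℕ using (ℕ; zero; suc; _∸_; _≤_; _<_; z≤n; s≤s)
  import Data.Nat.Properties as ℕP
  open import Data.Nat.Divisibility using (_∣?_; divides; ∣m+n∣m⇒∣n; ∣m∣n⇒∣m+n; ∣-refl; ∣⇒≤)
  open import Data.Integer using (ℤ; 0ℤ; 1ℤ; _+_; _*_; _-_)
  import Data.Integer.Properties as ℤP
  open import Data.Integer.Tactic.RingSolver using (solve-∀)
  open import Data.Empty using (⊥-elim)
  open import Level using (0ℓ)
  open import Relation.Nullary using (yes; no; Dec)
  open import Relation.Binary.Bundles using (Setoid)
  open import Relation.Binary.Definitions using (tri<; tri≈; tri>)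
  open import Relation.Binary.PropositionalEquality
  import Relation.Binary.Reasoning.Setoid as SetoidReasoning

  infix 4 _≈_
  _≈_ : PS → PS → Set
  f ≈ g = ∀ n → f n ≡ g n

  ≈-setoid : Setoid 0ℓ 0ℓ
  ≈-setoid = record
    { Carrier       = PS
    ; _≈_           = _≈_
    ; isEquivalence = record
      { refl  = λ _ → refl
      ; sym   = λ p n → sym (p n)
      ; trans = λ p q n → trans (p n) (q n)
      }
    }

  open Setoid ≈-setoid public using () renaming (refl to ≈-refl; sym to ≈-sym; trans to ≈-trans)
  module ≈-Reasoning = SetoidReasoning ≈-setoid

  Σ<-cong : ∀ n {f g : ℕ → ℤ} → (∀ i → i < n → f i ≡ g i) → Σ< n f ≡ Σ< n g
  Σ<-cong zero    p = refl
  Σ<-cong (suc n) p = cong₂ _+_ (Σ<-cong n (λ i i<n → p i (ℕP.m<n⇒m<1+n i<n))) (p n ℕP.≤-refl)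

  Σ<-+ : ∀ n (f g : ℕ → ℤ) → Σ< n (λ i → f i + g i) ≡ Σ< n f + Σ< n g
  Σ<-+ zero    f g = refl
  Σ<-+ (suc n) f g = trans (cong (_+ (f n + g n)) (Σ<-+ n f g)) (interchange (Σ< n f) (Σ< n g) (f n) (g n))
    where interchange : ∀ a b c d → (a + b) + (c + d) ≡ (a + c) + (b + d)
          interchange = solve-∀

  Σ<-- : ∀ n (f g : ℕ → ℤ) → Σ< n (λ i → f i - g i) ≡ Σ< n f - Σ< n g
  Σ<-- zero    f g = refl
  Σ<-- (suc n) f g = trans (cong (_+ (f n - g n)) (Σ<-- n f g)) (interchange (Σ< n f) (Σ< n g) (f n) (g n))
    where interchange : ∀ a b c d → (a - b) + (c - d) ≡ (a + c) - (b + d)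
          interchange = solve-∀

  Σ<-*ˡ : ∀ n c (f : ℕ → ℤ) → Σ< n (λ i → c * f i) ≡ c * Σ< n f
  Σ<-*ˡ zero    c f = sym (ℤP.*-zeroʳ c)
  Σ<-*ˡ (suc n) c f = trans (cong (_+ (c * f n)) (Σ<-*ˡ n c f)) (sym (ℤP.*-distribˡ-+ c (Σ< n f) (f n)))

  Σ<-zero : ∀ n (f : ℕ → ℤ) → (∀ i → i < n → f i ≡ 0ℤ) → Σ< n f ≡ 0ℤ
  Σ<-zero zero    f p = refl
  Σ<-zero (suc n) f p = cong₂ _+_ (Σ<-zero n f (λ i i<n → p i (ℕP.m<n⇒m<1+n i<n))) (p n ℕP.≤-refl)

  Σ<-head : ∀ n (f : ℕ → ℤ) → Σ< (suc n) f ≡ f 0 + Σ< n (λ i → f (suc i))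
  Σ<-head zero    f = ℤP.+-comm 0ℤ (f 0)
  Σ<-head (suc n) f = trans (cong (_+ f (suc n)) (Σ<-head n f)) (ℤP.+-assoc (f 0) _ _)

  Σ<-pad : ∀ m k (f : ℕ → ℤ) → (∀ i → m ≤ i → f i ≡ 0ℤ) → Σ< (k ℕ.+ m) f ≡ Σ< m f
  Σ<-pad m zero    f p = refl
  Σ<-pad m (suc k) f p = trans (cong₂ _+_ (Σ<-pad m k f p) (p (k ℕ.+ m) (ℕP.m≤n+m m k))) (ℤP.+-identityʳ _)

  -ₚ-congˡ : ∀ f {g h} → g ≈ h → f -ₚ g ≈ f -ₚ h
  -ₚ-congˡ f g≈h n = cong (λ x → f n - x) (g≈h n)

  +ₚ-vanishingˡ : ∀ {f} g → f ≈ 0ₚ → f +ₚ g ≈ g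
  +ₚ-vanishingˡ g f≈0 n = trans (cong (_+ g n) (f≈0 n)) (ℤP.+-identityˡ (g n))

  tail : PS → PS
  tail f n = f (suc n)

  scale : ℤ → PS → PS
  scale c f n = c * f n

  *-zeroth : ∀ f g → (f *ₚ g) 0 ≡ f 0 * g 0
  *-zeroth f g = ℤP.+-identityˡ _

  *-suc : ∀ f g n → (f *ₚ g) (suc n) ≡ f 0 * g (suc n) + (tail f *ₚ g) n
  *-suc f g n = Σ<-head (suc n) (λ i → f i * g (suc n ∸ i))

  *-cong : ∀ {f f′ g g′} → f ≈ f′ → g ≈ g′ → f *ₚ g ≈ f′ *ₚ g′
  *-cong p q n = Σ<-cong (suc n) (λ i _ → cong₂ _*_ (p i) (q (n ∸ i)))

  *-distribʳ-+ : ∀ f g h → (f +ₚ g) *ₚ h ≈ (f *ₚ h) +ₚ (g *ₚ h)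
  *-distribʳ-+ f g h n =
    trans (Σ<-cong (suc n) (λ i _ → ℤP.*-distribʳ-+ (h (n ∸ i)) (f i) _)) (Σ<-+ (suc n) _ _)

  *-distribˡ-- : ∀ f g h → f *ₚ (g -ₚ h) ≈ (f *ₚ g) -ₚ (f *ₚ h)
  *-distribˡ-- f g h n = trans (Σ<-cong (suc n) (λ i _ → distrib (f i) _ _)) (Σ<-- (suc n) _ _)
    where distrib : ∀ a b c → a * (b - c) ≡ a * b - a * c
          distrib = solve-∀

  *-distribʳ-- : ∀ f g h → (f -ₚ g) *ₚ h ≈ (f *ₚ h) -ₚ (g *ₚ h)
  *-distribʳ-- f g h n = trans (Σ<-cong (suc n) (λ i _ → distrib (f i) _ _)) (Σ<-- (suc n) _ _)
    where distrib : ∀ a b c → (a - b) * c ≡ a * c - b * c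
          distrib = solve-∀

  *-zeroˡ : ∀ f g → f ≈ 0ₚ → f *ₚ g ≈ 0ₚ
  *-zeroˡ f g p n = Σ<-zero (suc n) _ (λ i _ → trans (cong (_* g (n ∸ i)) (p i)) (ℤP.*-zeroˡ (g (n ∸ i))))

  *-zeroʳ : ∀ f g → g ≈ 0ₚ → f *ₚ g ≈ 0ₚ
  *-zeroʳ f g p n = Σ<-zero (suc n) _ (λ i _ → trans (cong (f i *_) (p (n ∸ i))) (ℤP.*-zeroʳ (f i)))

  *-scaleˡ : ∀ c f g → scale c f *ₚ g ≈ scale c (f *ₚ g)
  *-scaleˡ c f g n = trans (Σ<-cong (suc n) (λ i _ → ℤP.*-assoc c (f i) _)) (Σ<-*ˡ (suc n) c _)

  tail-* : ∀ f g → tail (f *ₚ g) ≈ scale (f 0) (tail g) +ₚ (tail f *ₚ g)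
  tail-* f g n = *-suc f g n

  *-comm : ∀ f g → f *ₚ g ≈ g *ₚ f
  *-comm f g zero = trans (*-zeroth f g) (trans (ℤP.*-comm (f 0) (g 0)) (sym (*-zeroth g f)))
  *-comm f g (suc zero) = begin
    (f *ₚ g) 1                   ≡⟨ *-suc f g 0 ⟩
    f 0 * g 1 + (tail f *ₚ g) 0  ≡⟨ cong (f 0 * g 1 +_) (*-zeroth (tail f) g) ⟩
    f 0 * g 1 + f 1 * g 0        ≡⟨ swap (f 0) (g 1) (f 1) (g 0) ⟩
    g 0 * f 1 + g 1 * f 0        ≡⟨ cong (g 0 * f 1 +_) (*-zeroth (tail g) f) ⟨
    g 0 * f 1 + (tail g *ₚ f) 0  ≡⟨ *-suc g f 0 ⟨
    (g *ₚ f) 1                   ∎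
    where open ≡-Reasoning
          swap : ∀ a b c d → a * b + c * d ≡ d * c + b * a
          swap = solve-∀
  *-comm f g (suc (suc n)) = begin
    (f *ₚ g) (2 ℕ.+ n)                                ≡⟨ *-suc f g (suc n) ⟩
    f 0 * g (2 ℕ.+ n) + (tail f *ₚ g) (suc n)         ≡⟨ cong (f 0 * g (2 ℕ.+ n) +_) (*-comm (tail f) g (suc n)) ⟩
    f 0 * g (2 ℕ.+ n) + (g *ₚ tail f) (suc n)         ≡⟨ cong (f 0 * g (2 ℕ.+ n) +_) (*-suc g (tail f) n) ⟩
    f 0 * g (2 ℕ.+ n) + (g 0 * f (2 ℕ.+ n) + (tail g *ₚ tail f) n)
      ≡⟨ cong (λ x → f 0 * g (2 ℕ.+ n) + (g 0 * f (2 ℕ.+ n) + x)) (*-comm (tail g) (tail f) n) ⟩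
    f 0 * g (2 ℕ.+ n) + (g 0 * f (2 ℕ.+ n) + (tail f *ₚ tail g) n)
      ≡⟨ swap (f 0 * g (2 ℕ.+ n)) (g 0 * f (2 ℕ.+ n)) _ ⟩
    g 0 * f (2 ℕ.+ n) + (f 0 * g (2 ℕ.+ n) + (tail f *ₚ tail g) n)
      ≡⟨ cong (g 0 * f (2 ℕ.+ n) +_) (*-suc f (tail g) n) ⟨
    g 0 * f (2 ℕ.+ n) + (f *ₚ tail g) (suc n)         ≡⟨ cong (g 0 * f (2 ℕ.+ n) +_) (*-comm (tail g) f (suc n)) ⟨
    g 0 * f (2 ℕ.+ n) + (tail g *ₚ f) (suc n)         ≡⟨ *-suc g f (suc n) ⟨
    (g *ₚ f) (2 ℕ.+ n)                                ∎
    where open ≡-Reasoning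
          swap : ∀ a b c → a + (b + c) ≡ b + (a + c)
          swap = solve-∀

  *-assoc : ∀ f g h → (f *ₚ g) *ₚ h ≈ f *ₚ (g *ₚ h)
  *-assoc f g h zero = begin
    ((f *ₚ g) *ₚ h) 0  ≡⟨ *-zeroth (f *ₚ g) h ⟩
    (f *ₚ g) 0 * h 0   ≡⟨ cong (_* h 0) (*-zeroth f g) ⟩
    f 0 * g 0 * h 0    ≡⟨ ℤP.*-assoc (f 0) (g 0) (h 0) ⟩
    f 0 * (g 0 * h 0)  ≡⟨ cong (f 0 *_) (*-zeroth g h) ⟨
    f 0 * (g *ₚ h) 0   ≡⟨ *-zeroth f (g *ₚ h) ⟨
    (f *ₚ (g *ₚ h)) 0  ∎
    where open ≡-Reasoning
  *-assoc f g h (suc n) = begin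
    ((f *ₚ g) *ₚ h) (suc n)
      ≡⟨ *-suc (f *ₚ g) h n ⟩
    (f *ₚ g) 0 * h (suc n) + (tail (f *ₚ g) *ₚ h) n
      ≡⟨ cong₂ _+_ (cong (_* h (suc n)) (*-zeroth f g)) (*-cong (tail-* f g) (≈-refl {h}) n) ⟩
    f 0 * g 0 * h (suc n) + ((scale (f 0) (tail g) +ₚ (tail f *ₚ g)) *ₚ h) n
      ≡⟨ cong (f 0 * g 0 * h (suc n) +_) (*-distribʳ-+ (scale (f 0) (tail g)) (tail f *ₚ g) h n) ⟩
    f 0 * g 0 * h (suc n) + ((scale (f 0) (tail g) *ₚ h) n + ((tail f *ₚ g) *ₚ h) n)
      ≡⟨ cong (f 0 * g 0 * h (suc n) +_) (cong₂ _+_ (*-scaleˡ (f 0) (tail g) h n) (*-assoc (tail f) g h n)) ⟩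
    f 0 * g 0 * h (suc n) + (f 0 * (tail g *ₚ h) n + (tail f *ₚ (g *ₚ h)) n)
      ≡⟨ regroup (f 0) (g 0) (h (suc n)) ((tail g *ₚ h) n) ((tail f *ₚ (g *ₚ h)) n) ⟩
    f 0 * (g 0 * h (suc n) + (tail g *ₚ h) n) + (tail f *ₚ (g *ₚ h)) n
      ≡⟨ cong (λ x → f 0 * x + (tail f *ₚ (g *ₚ h)) n) (*-suc g h n) ⟨
    f 0 * (g *ₚ h) (suc n) + (tail f *ₚ (g *ₚ h)) n
      ≡⟨ *-suc f (g *ₚ h) n ⟨
    (f *ₚ (g *ₚ h)) (suc n) ∎
    where open ≡-Reasoning
          regroup : ∀ a b c d e → a * b * c + (a * d + e) ≡ a * (b * c + d) + e
          regroup = solve-∀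

  *-identityˡ : ∀ f → 1ₚ *ₚ f ≈ f
  *-identityˡ f zero    = trans (*-zeroth 1ₚ f) (ℤP.*-identityˡ (f 0))
  *-identityˡ f (suc n) = begin
    (1ₚ *ₚ f) (suc n)                          ≡⟨ *-suc 1ₚ f n ⟩
    1ℤ * f (suc n) + (tail 1ₚ *ₚ f) n          ≡⟨ cong₂ _+_ (ℤP.*-identityˡ (f (suc n))) (*-zeroˡ (tail 1ₚ) f (λ _ → refl) n) ⟩
    f (suc n) + 0ℤ                             ≡⟨ ℤP.+-identityʳ _ ⟩
    f (suc n)                                  ∎
    where open ≡-Reasoning

  shift-pointwise : (_∙_ : ℤ → ℤ → ℤ) → 0ℤ ∙ 0ℤ ≡ 0ℤ →
                    ∀ e f g → shift e (λ n → f n ∙ g n) ≈ (λ n → shift e f n ∙ shift e g n)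
  shift-pointwise _∙_ 0∙0≡0 e f g n with n ℕ.<? e
  ... | yes _ = sym 0∙0≡0
  ... | no  _ = refl

  shift-+ : ∀ e f g → shift e (f +ₚ g) ≈ shift e f +ₚ shift e g
  shift-+ = shift-pointwise _+_ refl

  shift-- : ∀ e f g → shift e (f -ₚ g) ≈ shift e f -ₚ shift e g
  shift-- = shift-pointwise _-_ refl

  shift-cong : ∀ e {f g} → f ≈ g → shift e f ≈ shift e g
  shift-cong e p n with n ℕ.<? e
  ... | yes _ = refl
  ... | no  _ = p (n ∸ e)

  shift-0ₚ : ∀ e {f} → f ≈ 0ₚ → shift e f ≈ 0ₚ
  shift-0ₚ e p n with n ℕ.<? e
  ... | yes _ = refl
  ... | no  _ = p (n ∸ e)

  shift-< : ∀ e f {n} → n < e → shift e f n ≡ 0ℤ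
  shift-< e f {n} n<e with n ℕ.<? e
  ... | yes _   = refl
  ... | no  n≮e = ⊥-elim (n≮e n<e)

  shift-≥ : ∀ e f {n} → e ≤ n → shift e f n ≡ f (n ∸ e)
  shift-≥ e f {n} e≤n with n ℕ.<? e
  ... | yes n<e = ⊥-elim (ℕP.<⇒≱ n<e e≤n)
  ... | no  _   = refl

  shift-by-0 : ∀ f → shift 0 f ≈ f
  shift-by-0 f n = shift-≥ 0 f z≤n

  shift-suc-zero : ∀ e f → shift (suc e) f 0 ≡ 0ℤ
  shift-suc-zero e f = shift-< (suc e) f (s≤s z≤n)

  shift-suc-suc : ∀ e f n → shift (suc e) f (suc n) ≡ shift e f n
  shift-suc-suc e f n with suc n ℕ.<? suc e | n ℕ.<? e
  ... | yes _   | yes _   = refl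
  ... | no  _   | no  _   = refl
  ... | yes n<e | no  n≮e = ⊥-elim (n≮e (ℕP.≤-pred n<e))
  ... | no  n≮e | yes n<e = ⊥-elim (n≮e (s≤s n<e))

  shift-shift : ∀ a b f → shift a (shift b f) ≈ shift (a ℕ.+ b) f
  shift-shift zero    b f n       = shift-by-0 (shift b f) n
  shift-shift (suc a) b f zero    = trans (shift-suc-zero a (shift b f)) (sym (shift-suc-zero (a ℕ.+ b) f))
  shift-shift (suc a) b f (suc n) =
    trans (shift-suc-suc a _ n) (trans (shift-shift a b f n) (sym (shift-suc-suc (a ℕ.+ b) f n)))

  shift-*ˡ : ∀ e f g → shift e f *ₚ g ≈ shift e (f *ₚ g)
  shift-*ˡ zero f g n = trans (*-cong (shift-by-0 f) (≈-refl {g}) n) (sym (shift-by-0 (f *ₚ g) n))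
  shift-*ˡ (suc e) f g zero = begin
    (shift (suc e) f *ₚ g) 0   ≡⟨ *-zeroth (shift (suc e) f) g ⟩
    shift (suc e) f 0 * g 0    ≡⟨ cong (_* g 0) (shift-suc-zero e f) ⟩
    0ℤ * g 0                   ≡⟨ shift-suc-zero e (f *ₚ g) ⟨
    shift (suc e) (f *ₚ g) 0   ∎
    where open ≡-Reasoning
  shift-*ˡ (suc e) f g (suc n) = begin
    (shift (suc e) f *ₚ g) (suc n)
      ≡⟨ *-suc (shift (suc e) f) g n ⟩
    shift (suc e) f 0 * g (suc n) + (tail (shift (suc e) f) *ₚ g) n
      ≡⟨ cong₂ _+_ (cong (_* g (suc n)) (shift-suc-zero e f)) (*-cong (shift-suc-suc e f) (≈-refl {g}) n) ⟩
    0ℤ * g (suc n) + (shift e f *ₚ g) n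
      ≡⟨ cong (0ℤ * g (suc n) +_) (shift-*ˡ e f g n) ⟩
    0ℤ + shift e (f *ₚ g) n
      ≡⟨ ℤP.+-identityˡ _ ⟩
    shift e (f *ₚ g) n
      ≡⟨ shift-suc-suc e (f *ₚ g) n ⟨
    shift (suc e) (f *ₚ g) (suc n) ∎
    where open ≡-Reasoning

  shift-*ʳ : ∀ e f g → f *ₚ shift e g ≈ shift e (f *ₚ g)
  shift-*ʳ e f g = ≈-trans (*-comm f (shift e g)) (≈-trans (shift-*ˡ e g f) (shift-cong e (*-comm g f)))

  ΣPS<-cong : ∀ n {F G : ℕ → PS} → (∀ j → j < n → F j ≈ G j) → ΣPS< n F ≈ ΣPS< n G
  ΣPS<-cong n p c = Σ<-cong n (λ j j<n → p j j<n c)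

  ΣPS<-- : ∀ n (F G : ℕ → PS) → ΣPS< n (λ j → F j -ₚ G j) ≈ ΣPS< n F -ₚ ΣPS< n G
  ΣPS<-- n F G c = Σ<-- n (λ j → F j c) (λ j → G j c)

  ΣPS<-head : ∀ n (F : ℕ → PS) → ΣPS< (suc n) F ≈ F 0 +ₚ ΣPS< n (λ j → F (suc j))
  ΣPS<-head n F c = Σ<-head n (λ j → F j c)

  ΣPS<-*ʳ : ∀ n (F : ℕ → PS) g → ΣPS< n F *ₚ g ≈ ΣPS< n (λ j → F j *ₚ g)
  ΣPS<-*ʳ zero    F g = *-zeroˡ _ g (λ _ → refl)
  ΣPS<-*ʳ (suc n) F g c =
    trans (*-distribʳ-+ (ΣPS< n F) (F n) g c) (cong (_+ (F n *ₚ g) c) (ΣPS<-*ʳ n F g c))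

  ΣPS<-*ˡ : ∀ n f (G : ℕ → PS) → f *ₚ ΣPS< n G ≈ ΣPS< n (λ j → f *ₚ G j)
  ΣPS<-*ˡ n f G = ≈-trans (*-comm f (ΣPS< n G)) (≈-trans (ΣPS<-*ʳ n G f) (ΣPS<-cong n (λ j _ → *-comm (G j) f)))

  ΣPS<-shift : ∀ n e (F : ℕ → PS) → shift e (ΣPS< n F) ≈ ΣPS< n (λ j → shift e (F j))
  ΣPS<-shift zero    e F = shift-0ₚ e (λ _ → refl)
  ΣPS<-shift (suc n) e F c =
    trans (shift-+ e (ΣPS< n F) (F n) c) (cong (_+ shift e (F n) c) (ΣPS<-shift n e F c))

  1ₚ-pos : ∀ {n} → 0 < n → 1ₚ n ≡ 0ℤ
  1ₚ-pos (s≤s _) = refl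

  shift-1ₚ-≡ : ∀ j → shift j 1ₚ j ≡ 1ℤ
  shift-1ₚ-≡ j = trans (shift-≥ j 1ₚ ℕP.≤-refl) (cong 1ₚ (ℕP.n∸n≡0 j))

  shift-1ₚ-≢ : ∀ {j n} → n ≢ j → shift j 1ₚ n ≡ 0ℤ
  shift-1ₚ-≢ {j} {n} n≢j with n ℕ.<? j
  ... | yes _   = refl
  ... | no  n≮j = 1ₚ-pos (ℕP.m<n⇒0<n∸m (ℕP.≤∧≢⇒< (ℕP.≮⇒≥ n≮j) (λ j≡n → n≢j (sym j≡n))))

  oneMinusQ^-≈ : ∀ j → oneMinusQ^ j ≈ 1ₚ -ₚ shift j 1ₚ
  oneMinusQ^-≈ j n with n ℕ.≟ 0 | n ℕ.≟ j
  oneMinusQ^-≈ j .0 | yes refl | yes refl = sym (cong (λ x → 1ℤ - x) (shift-1ₚ-≡ 0))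
  oneMinusQ^-≈ j .0 | yes refl | no  0≢j  = sym (cong (λ x → 1ℤ - x) (shift-1ₚ-≢ 0≢j))
  oneMinusQ^-≈ j n  | no  n≢0  | yes refl =
    sym (cong₂ _-_ (1ₚ-pos (ℕP.n≢0⇒n>0 n≢0)) (shift-1ₚ-≡ n))
  oneMinusQ^-≈ j n  | no  n≢0  | no  n≢j  =
    sym (cong₂ _-_ (1ₚ-pos (ℕP.n≢0⇒n>0 n≢0)) (shift-1ₚ-≢ n≢j))

  oneMinusQ^-*ˡ : ∀ j f → oneMinusQ^ j *ₚ f ≈ f -ₚ shift j f
  oneMinusQ^-*ˡ j f = begin
    oneMinusQ^ j *ₚ f                    ≈⟨ *-cong (oneMinusQ^-≈ j) (≈-refl {f}) ⟩
    (1ₚ -ₚ shift j 1ₚ) *ₚ f              ≈⟨ *-distribʳ-- 1ₚ (shift j 1ₚ) f ⟩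
    (1ₚ *ₚ f) -ₚ (shift j 1ₚ *ₚ f)       ≈⟨ (λ n → cong₂ _-_ (*-identityˡ f n) (shift-*ˡ j 1ₚ f n)) ⟩
    f -ₚ shift j (1ₚ *ₚ f)               ≈⟨ -ₚ-congˡ f (shift-cong j (*-identityˡ f)) ⟩
    f -ₚ shift j f                       ∎
    where open ≈-Reasoning

  oneMinusQ^-0 : oneMinusQ^ 0 ≈ 0ₚ
  oneMinusQ^-0 n = trans (oneMinusQ^-≈ 0 n) (trans (cong (λ x → 1ₚ n - x) (shift-by-0 1ₚ n)) (ℤP.+-inverseʳ (1ₚ n)))

  geom-periodic : ∀ d n → geom d (d ℕ.+ n) ≡ geom d n
  geom-periodic d n with d ∣? (d ℕ.+ n) | d ∣? n
  ... | yes _       | yes _     = refl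
  ... | no  _       | no  _     = refl
  ... | yes d∣d+n   | no  d∤n   = ⊥-elim (d∤n (∣m+n∣m⇒∣n d∣d+n ∣-refl))
  ... | no  d∤d+n   | yes d∣n   = ⊥-elim (d∤d+n (∣m∣n⇒∣m+n ∣-refl d∣n))

  geom-< : ∀ j n → n < suc j → geom (suc j) n ≡ 1ₚ n
  geom-< j zero    _ with suc j ∣? 0
  ... | yes _   = refl
  ... | no  d∤0 = ⊥-elim (d∤0 (divides 0 refl))
  geom-< j (suc n) n<d with suc j ∣? suc n
  ... | yes d∣n = ⊥-elim (ℕP.<⇒≱ n<d (∣⇒≤ d∣n))
  ... | no  _   = refl

  geom-*-oneMinusQ^ : ∀ j → geom (suc j) *ₚ oneMinusQ^ (suc j) ≈ 1ₚ
  geom-*-oneMinusQ^ j = ≈-trans (*-comm (geom (suc j)) (oneMinusQ^ (suc j))) (≈-trans (oneMinusQ^-*ˡ (suc j) g) telescoped)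
    where
    g = geom (suc j)
    telescoped : g -ₚ shift (suc j) g ≈ 1ₚ
    telescoped n with n ℕ.<? suc j
    ... | yes n<d = trans (ℤP.+-identityʳ (g n)) (geom-< j n n<d)
    ... | no  n≮d = begin
      g n - g (n ∸ suc j)                      ≡⟨ cong (λ x → g x - g (n ∸ suc j)) (ℕP.m+[n∸m]≡n d≤n) ⟨
      g (suc j ℕ.+ (n ∸ suc j)) - g (n ∸ suc j) ≡⟨ cong (_- g (n ∸ suc j)) (geom-periodic (suc j) (n ∸ suc j)) ⟩
      g (n ∸ suc j) - g (n ∸ suc j)             ≡⟨ ℤP.+-inverseʳ (g (n ∸ suc j)) ⟩
      0ℤ                                       ≡⟨ 1ₚ-pos (ℕP.<-≤-trans (s≤s z≤n) d≤n) ⟨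
      1ₚ n                                     ∎
      where open ≡-Reasoning
            d≤n = ℕP.≮⇒≥ n≮d

  xy*z≈xz*y : ∀ x y z → (x *ₚ y) *ₚ z ≈ (x *ₚ z) *ₚ y
  xy*z≈xz*y x y z = ≈-trans (*-assoc x y z) (≈-trans (*-cong (≈-refl {x}) (*-comm y z)) (≈-sym (*-assoc x z y)))

  invPoch-*-oneMinusQ^ : ∀ N → invPoch (suc N) *ₚ oneMinusQ^ (suc N) ≈ invPoch N
  invPoch-*-oneMinusQ^ N = begin
    (invPoch N *ₚ geom (suc N)) *ₚ oneMinusQ^ (suc N)  ≈⟨ *-assoc (invPoch N) (geom (suc N)) (oneMinusQ^ (suc N)) ⟩
    invPoch N *ₚ (geom (suc N) *ₚ oneMinusQ^ (suc N))  ≈⟨ *-cong (≈-refl {invPoch N}) (geom-*-oneMinusQ^ N) ⟩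
    invPoch N *ₚ 1ₚ                                    ≈⟨ *-comm (invPoch N) 1ₚ ⟩
    1ₚ *ₚ invPoch N                                    ≈⟨ *-identityˡ (invPoch N) ⟩
    invPoch N                                          ∎
    where open ≈-Reasoning

  qbin-≤ : ∀ {N M} → M ≤ N → qbin N M ≈ (poch N *ₚ invPoch M) *ₚ invPoch (N ∸ M)
  qbin-≤ {N} {M} M≤N n with M ℕ.≤? N
  ... | yes _   = refl
  ... | no  M≰N = ⊥-elim (M≰N M≤N)

  qbin-> : ∀ {N M} → N < M → qbin N M ≈ 0ₚ
  qbin-> {N} {M} N<M n with M ℕ.≤? N
  ... | yes M≤N = ⊥-elim (ℕP.<⇒≱ N<M M≤N)
  ... | no  _   = refl

  absorb-oneMinusQ^ : ∀ P a K → ((poch (suc P) *ₚ a) *ₚ invPoch (suc K)) *ₚ oneMinusQ^ (suc K)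
                                ≈ oneMinusQ^ (suc P) *ₚ ((poch P *ₚ a) *ₚ invPoch K)
  absorb-oneMinusQ^ P a K = begin
    (((poch P *ₚ ω) *ₚ a) *ₚ invPoch (suc K)) *ₚ oneMinusQ^ (suc K)
      ≈⟨ *-assoc ((poch P *ₚ ω) *ₚ a) (invPoch (suc K)) (oneMinusQ^ (suc K)) ⟩
    ((poch P *ₚ ω) *ₚ a) *ₚ (invPoch (suc K) *ₚ oneMinusQ^ (suc K))
      ≈⟨ *-cong (xy*z≈xz*y (poch P) ω a) (invPoch-*-oneMinusQ^ K) ⟩
    ((poch P *ₚ a) *ₚ ω) *ₚ invPoch K
      ≈⟨ xy*z≈xz*y (poch P *ₚ a) ω (invPoch K) ⟩
    ((poch P *ₚ a) *ₚ invPoch K) *ₚ ω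
      ≈⟨ *-comm ((poch P *ₚ a) *ₚ invPoch K) ω ⟩
    ω *ₚ ((poch P *ₚ a) *ₚ invPoch K) ∎
    where open ≈-Reasoning
          ω = oneMinusQ^ (suc P)

  qbin-*-oneMinusQ^-∸ : ∀ N N′ → qbin N N′ *ₚ oneMinusQ^ (N ∸ N′) ≈ oneMinusQ^ N *ₚ qbin (N ∸ 1) N′
  qbin-*-oneMinusQ^-∸ N N′ with ℕP.<-cmp N′ N
  qbin-*-oneMinusQ^-∸ (suc P) N′ | tri< N′<N _ _ = begin
    qbin (suc P) N′ *ₚ oneMinusQ^ (suc P ∸ N′)
      ≈⟨ *-cong (qbin-≤ (ℕP.<⇒≤ N′<N)) (≈-refl {oneMinusQ^ (suc P ∸ N′)}) ⟩
    ((poch (suc P) *ₚ invPoch N′) *ₚ invPoch (suc P ∸ N′)) *ₚ oneMinusQ^ (suc P ∸ N′)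
      ≡⟨ cong (λ K → ((poch (suc P) *ₚ invPoch N′) *ₚ invPoch K) *ₚ oneMinusQ^ K) (ℕP.+-∸-assoc 1 N′≤P) ⟩
    ((poch (suc P) *ₚ invPoch N′) *ₚ invPoch (suc (P ∸ N′))) *ₚ oneMinusQ^ (suc (P ∸ N′))
      ≈⟨ absorb-oneMinusQ^ P (invPoch N′) (P ∸ N′) ⟩
    oneMinusQ^ (suc P) *ₚ ((poch P *ₚ invPoch N′) *ₚ invPoch (P ∸ N′))
      ≈⟨ *-cong (≈-refl {oneMinusQ^ (suc P)}) (qbin-≤ N′≤P) ⟨
    oneMinusQ^ (suc P) *ₚ qbin P N′ ∎
    where open ≈-Reasoning
          N′≤P = ℕP.≤-pred N′<N
  qbin-*-oneMinusQ^-∸ N .N | tri≈ _ refl _ =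
    ≈-trans (*-zeroʳ (qbin N N) (oneMinusQ^ (N ∸ N)) (λ n → trans (cong (λ K → oneMinusQ^ K n) (ℕP.n∸n≡0 N)) (oneMinusQ^-0 n)))
            (≈-sym (vanishes N))
    where vanishes : ∀ N → oneMinusQ^ N *ₚ qbin (N ∸ 1) N ≈ 0ₚ
          vanishes zero    = *-zeroˡ (oneMinusQ^ 0) (qbin 0 0) oneMinusQ^-0
          vanishes (suc P) = *-zeroʳ (oneMinusQ^ (suc P)) (qbin P (suc P)) (qbin-> {P} {suc P} ℕP.≤-refl)
  qbin-*-oneMinusQ^-∸ N N′ | tri> _ _ N<N′ =
    ≈-trans (*-zeroˡ (qbin N N′) (oneMinusQ^ (N ∸ N′)) (qbin-> N<N′))
            (≈-sym (*-zeroʳ (oneMinusQ^ N) (qbin (N ∸ 1) N′) (qbin-> (ℕP.≤-<-trans (ℕP.m∸n≤m N 1) N<N′))))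

  qbin-suc-*-oneMinusQ^ : ∀ P N → qbin P (suc N) *ₚ oneMinusQ^ (suc N) ≈ oneMinusQ^ P *ₚ qbin (P ∸ 1) N
  qbin-suc-*-oneMinusQ^ zero N =
    ≈-trans (*-zeroˡ (qbin 0 (suc N)) (oneMinusQ^ (suc N)) (qbin-> {0} {suc N} (s≤s z≤n))) (≈-sym (*-zeroˡ (oneMinusQ^ 0) (qbin 0 N) oneMinusQ^-0))
  qbin-suc-*-oneMinusQ^ (suc P) N = by-cases (N ℕ.≤? P)
    where
    by-cases : Dec (N ≤ P) → qbin (suc P) (suc N) *ₚ oneMinusQ^ (suc N) ≈ oneMinusQ^ (suc P) *ₚ qbin P N
    by-cases (yes N≤P) = begin
      qbin (suc P) (suc N) *ₚ oneMinusQ^ (suc N)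
        ≈⟨ *-cong (qbin-≤ (s≤s N≤P)) (≈-refl {oneMinusQ^ (suc N)}) ⟩
      ((poch (suc P) *ₚ invPoch (suc N)) *ₚ invPoch (P ∸ N)) *ₚ oneMinusQ^ (suc N)
        ≈⟨ *-cong (xy*z≈xz*y (poch (suc P)) (invPoch (suc N)) (invPoch (P ∸ N))) (≈-refl {oneMinusQ^ (suc N)}) ⟩
      ((poch (suc P) *ₚ invPoch (P ∸ N)) *ₚ invPoch (suc N)) *ₚ oneMinusQ^ (suc N)
        ≈⟨ absorb-oneMinusQ^ P (invPoch (P ∸ N)) N ⟩
      oneMinusQ^ (suc P) *ₚ ((poch P *ₚ invPoch (P ∸ N)) *ₚ invPoch N)
        ≈⟨ *-cong (≈-refl {oneMinusQ^ (suc P)}) (xy*z≈xz*y (poch P) (invPoch (P ∸ N)) (invPoch N)) ⟩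
      oneMinusQ^ (suc P) *ₚ ((poch P *ₚ invPoch N) *ₚ invPoch (P ∸ N))
        ≈⟨ *-cong (≈-refl {oneMinusQ^ (suc P)}) (qbin-≤ N≤P) ⟨
      oneMinusQ^ (suc P) *ₚ qbin P N ∎
      where open ≈-Reasoning
    by-cases (no N≰P) =
      ≈-trans (*-zeroˡ (qbin (suc P) (suc N)) (oneMinusQ^ (suc N)) (qbin-> (s≤s (ℕP.≰⇒> N≰P))))
              (≈-sym (*-zeroʳ (oneMinusQ^ (suc P)) (qbin P N) (qbin-> (ℕP.≰⇒> N≰P))))

module TruncatedSums where

  open PowerSeries
  open import Data.Nat as ℕ using (ℕ; suc; _∸_; _≤_; _<_)
  import Data.Nat.Properties as ℕP
  open import Data.Nat.Combinatorics using (_C_; nCk+nC[k+1]≡[n+1]C[k+1]; nC1≡n)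
  import Data.Nat.Tactic.RingSolver as ℕSolver
  open import Data.Integer using (0ℤ; _+_; _-_)
  import Data.Integer.Properties as ℤP
  open import Data.Integer.Tactic.RingSolver using (solve-∀)
  open import Data.List using (List; []; _∷_; _++_; map)
  open import Relation.Binary.PropositionalEquality
  open import Relation.Nullary using (yes; no; Dec)

  layer : ℕ → (ℕ → PS) → ℕ → (ℕ → PS) → PS
  layer M w k X = ΣPS< (suc M) (λ N → shift ((N ℕ.+ k) C 2) (w N *ₚ X N))

  layer-cong : ∀ M w k {X Y} → (∀ N → N ≤ M → X N ≈ Y N) → layer M w k X ≈ layer M w k Y
  layer-cong M w k X≈Y =
    ΣPS<-cong (suc M) (λ N N≤M → shift-cong ((N ℕ.+ k) C 2) (*-cong (≈-refl {w N}) (X≈Y N (ℕP.≤-pred N≤M))))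

  layer-- : ∀ M w k X Y → layer M w k (λ N → X N -ₚ Y N) ≈ layer M w k X -ₚ layer M w k Y
  layer-- M w k X Y = ≈-trans (ΣPS<-cong (suc M) (λ N _ → distrib N)) (ΣPS<-- (suc M) _ _)
    where
    distrib : ∀ N → shift ((N ℕ.+ k) C 2) (w N *ₚ (X N -ₚ Y N))
                    ≈ shift ((N ℕ.+ k) C 2) (w N *ₚ X N) -ₚ shift ((N ℕ.+ k) C 2) (w N *ₚ Y N)
    distrib N = ≈-trans (shift-cong ((N ℕ.+ k) C 2) (*-distribˡ-- (w N) (X N) (Y N)))
                        (shift-- ((N ℕ.+ k) C 2) (w N *ₚ X N) (w N *ₚ Y N))

  layer-shrink : ∀ {M′ M} w k X → M′ ≤ M → (∀ N → M′ < N → w N ≈ 0ₚ) → layer M w k X ≈ layer M′ w k X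
  layer-shrink {M′} {M} w k X M′≤M w≈0 n = begin
    Σ< (suc M) (λ N → T N n)                     ≡⟨ cong (λ L → Σ< L (λ N → T N n)) length ⟨
    Σ< ((M ∸ M′) ℕ.+ suc M′) (λ N → T N n)       ≡⟨ Σ<-pad (suc M′) (M ∸ M′) (λ N → T N n) vanishes ⟩
    Σ< (suc M′) (λ N → T N n)                    ∎
    where
    open ≡-Reasoning
    T : ℕ → PS
    T N = shift ((N ℕ.+ k) C 2) (w N *ₚ X N)
    length : (M ∸ M′) ℕ.+ suc M′ ≡ suc M
    length = trans (ℕP.+-suc (M ∸ M′) M′) (cong suc (ℕP.m∸n+n≡m M′≤M))
    vanishes : ∀ N → suc M′ ≤ N → T N n ≡ 0ℤ
    vanishes N M′<N = shift-0ₚ ((N ℕ.+ k) C 2) (*-zeroˡ (w N) (X N) (w≈0 N M′<N)) n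

  inner-truncate : ∀ {M′ M} F ks P → P ≤ M′ → M′ ≤ M → inner M F P ks ≈ inner M′ F P ks
  inner-truncate F []       P _    _    = ≈-refl
  inner-truncate {M′} {M} F (k ∷ ks) P P≤M′ M′≤M =
    ≈-trans (layer-shrink (qbin P) k (λ N → inner M F N ks) M′≤M (λ N M′<N → qbin-> (ℕP.≤-<-trans P≤M′ M′<N)))
            (layer-cong M′ (qbin P) k (λ N N≤M′ → inner-truncate F ks N N≤M′ M′≤M))

  C2-suc : ∀ x → suc x C 2 ≡ x C 2 ℕ.+ x
  C2-suc x = trans (sym (nCk+nC[k+1]≡[n+1]C[k+1] x 1)) (trans (cong (ℕ._+ x C 2) (nC1≡n x)) (ℕP.+-comm x (x C 2)))

  ≤-suc-C2 : ∀ x → x ≤ suc x C 2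
  ≤-suc-C2 x = ℕP.≤-trans (ℕP.m≤n+m x (x C 2)) (ℕP.≤-reflexive (sym (C2-suc x)))

  𝔖≤-stable : ∀ M F ks {n} → n < M → 𝔖≤ (suc M) F ks n ≡ 𝔖≤ M F ks n
  𝔖≤-stable M F []       n<M = refl
  𝔖≤-stable M F (k ∷ ks) {n} n<M = begin
    layer (suc M) invPoch k (λ N → inner (suc M) F N ks) n
      ≡⟨ cong (_+ T (suc M) n) (layer-cong M invPoch k truncate n) ⟩
    𝔖≤ M F (k ∷ ks) n + T (suc M) n
      ≡⟨ cong (𝔖≤ M F (k ∷ ks) n +_) (shift-< ((suc M ℕ.+ k) C 2) _ n<exponent) ⟩
    𝔖≤ M F (k ∷ ks) n + 0ℤ
      ≡⟨ ℤP.+-identityʳ _ ⟩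
    𝔖≤ M F (k ∷ ks) n ∎
    where
    open ≡-Reasoning
    T : ℕ → PS
    T N = shift ((N ℕ.+ k) C 2) (invPoch N *ₚ inner (suc M) F N ks)
    truncate : ∀ N → N ≤ M → inner (suc M) F N ks ≈ inner M F N ks
    truncate N N≤M = inner-truncate F ks N N≤M (ℕP.n≤1+n M)
    n<exponent : n < (suc M ℕ.+ k) C 2
    n<exponent = ℕP.<-≤-trans n<M (ℕP.≤-trans (ℕP.m≤m+n M k) (≤-suc-C2 (M ℕ.+ k)))

  binomial-exponent : ∀ {N N′} c → N′ ≤ N → (N′ ℕ.+ suc c) C 2 ℕ.+ (N ∸ N′) ≡ (N ℕ.+ c) ℕ.+ (N′ ℕ.+ c) C 2
  binomial-exponent {N} {N′} c N′≤N = begin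
    (N′ ℕ.+ suc c) C 2 ℕ.+ (N ∸ N′)                   ≡⟨ cong (λ x → x C 2 ℕ.+ (N ∸ N′)) (ℕP.+-suc N′ c) ⟩
    suc (N′ ℕ.+ c) C 2 ℕ.+ (N ∸ N′)                   ≡⟨ cong (ℕ._+ (N ∸ N′)) (C2-suc (N′ ℕ.+ c)) ⟩
    ((N′ ℕ.+ c) C 2 ℕ.+ (N′ ℕ.+ c)) ℕ.+ (N ∸ N′)      ≡⟨ regroup ((N′ ℕ.+ c) C 2) N′ c (N ∸ N′) ⟩
    ((N′ ℕ.+ (N ∸ N′)) ℕ.+ c) ℕ.+ (N′ ℕ.+ c) C 2      ≡⟨ cong (λ x → (x ℕ.+ c) ℕ.+ (N′ ℕ.+ c) C 2) (ℕP.m+[n∸m]≡n N′≤N) ⟩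
    (N ℕ.+ c) ℕ.+ (N′ ℕ.+ c) C 2                      ∎
    where open ≡-Reasoning
          regroup : ∀ x n′ c d → (x ℕ.+ (n′ ℕ.+ c)) ℕ.+ d ≡ ((n′ ℕ.+ d) ℕ.+ c) ℕ.+ x
          regroup = ℕSolver.solve-∀

  -- q^{N+c} q^{C(N′+c,2)} = q^{C(N′+c+1,2)} q^{N-N′}, and q^{N-N′} [N;N′] = [N;N′] - (1 - q^N) [N-1;N′].
  shift-qbin-term : ∀ N N′ c h →
    shift (N ℕ.+ c) (shift ((N′ ℕ.+ c) C 2) (qbin N N′ *ₚ h))
    ≈ shift ((N′ ℕ.+ suc c) C 2) (qbin N N′ *ₚ h) -ₚ shift ((N′ ℕ.+ suc c) C 2) (oneMinusQ^ N *ₚ (qbin (N ∸ 1) N′ *ₚ h))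
  shift-qbin-term N N′ c h = begin
    shift (N ℕ.+ c) (shift ((N′ ℕ.+ c) C 2) Y)   ≈⟨ shift-shift (N ℕ.+ c) ((N′ ℕ.+ c) C 2) Y ⟩
    shift ((N ℕ.+ c) ℕ.+ (N′ ℕ.+ c) C 2) Y       ≈⟨ exponent (N′ ℕ.≤? N) ⟩
    shift (b ℕ.+ d) Y                            ≈⟨ shift-shift b d Y ⟨
    shift b (shift d Y)                          ≈⟨ shift-cong b (λ n → cancel (Y n) (shift d Y n)) ⟨
    shift b (Y -ₚ (Y -ₚ shift d Y))              ≈⟨ shift-cong b (λ n → cong (λ x → Y n - x) (factor n)) ⟨
    shift b (Y -ₚ Z)                             ≈⟨ shift-- b Y Z ⟩
    shift b Y -ₚ shift b Z                       ∎
    where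
    open ≈-Reasoning
    Y = qbin N N′ *ₚ h
    Z = oneMinusQ^ N *ₚ (qbin (N ∸ 1) N′ *ₚ h)
    b = (N′ ℕ.+ suc c) C 2
    d = N ∸ N′
    cancel : ∀ y z → y - (y - z) ≡ z
    cancel = solve-∀
    factor : Z ≈ Y -ₚ shift d Y
    factor = begin
      oneMinusQ^ N *ₚ (qbin (N ∸ 1) N′ *ₚ h)   ≈⟨ *-assoc (oneMinusQ^ N) (qbin (N ∸ 1) N′) h ⟨
      (oneMinusQ^ N *ₚ qbin (N ∸ 1) N′) *ₚ h   ≈⟨ *-cong (qbin-*-oneMinusQ^-∸ N N′) (≈-refl {h}) ⟨
      (qbin N N′ *ₚ oneMinusQ^ d) *ₚ h         ≈⟨ xy*z≈xz*y (qbin N N′) (oneMinusQ^ d) h ⟩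
      Y *ₚ oneMinusQ^ d                        ≈⟨ *-comm Y (oneMinusQ^ d) ⟩
      oneMinusQ^ d *ₚ Y                        ≈⟨ oneMinusQ^-*ˡ d Y ⟩
      Y -ₚ shift d Y                           ∎
    exponent : Dec (N′ ≤ N) → shift ((N ℕ.+ c) ℕ.+ (N′ ℕ.+ c) C 2) Y ≈ shift (b ℕ.+ d) Y
    exponent (yes N′≤N) n = cong (λ e → shift e Y n) (sym (binomial-exponent c N′≤N))
    exponent (no  N′≰N) = ≈-trans (shift-0ₚ ((N ℕ.+ c) ℕ.+ (N′ ℕ.+ c) C 2) Y≈0) (≈-sym (shift-0ₚ (b ℕ.+ d) Y≈0))
      where Y≈0 = *-zeroˡ (qbin N N′) h (qbin-> (ℕP.≰⇒> N′≰N))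

  shift-inner : ∀ M F c r N →
    shift (N ℕ.+ c) (inner M F N (c ∷ r))
    ≈ inner M F N (suc c ∷ r) -ₚ (oneMinusQ^ N *ₚ inner M F (N ∸ 1) (suc c ∷ r))
  shift-inner M F c r N = begin
    shift (N ℕ.+ c) (ΣPS< (suc M) (λ N′ → shift ((N′ ℕ.+ c) C 2) (qbin N N′ *ₚ H N′)))
      ≈⟨ ΣPS<-shift (suc M) (N ℕ.+ c) _ ⟩
    ΣPS< (suc M) (λ N′ → shift (N ℕ.+ c) (shift ((N′ ℕ.+ c) C 2) (qbin N N′ *ₚ H N′)))
      ≈⟨ ΣPS<-cong (suc M) (λ N′ _ → shift-qbin-term N N′ c (H N′)) ⟩
    ΣPS< (suc M) (λ N′ → A N′ -ₚ B N′)
      ≈⟨ ΣPS<-- (suc M) A B ⟩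
    inner M F N (suc c ∷ r) -ₚ ΣPS< (suc M) B
      ≈⟨ -ₚ-congˡ (inner M F N (suc c ∷ r)) factor-out ⟩
    inner M F N (suc c ∷ r) -ₚ (oneMinusQ^ N *ₚ inner M F (N ∸ 1) (suc c ∷ r)) ∎
    where
    open ≈-Reasoning
    H : ℕ → PS
    H N′ = inner M F N′ r
    A B : ℕ → PS
    A N′ = shift ((N′ ℕ.+ suc c) C 2) (qbin N N′ *ₚ H N′)
    B N′ = shift ((N′ ℕ.+ suc c) C 2) (oneMinusQ^ N *ₚ (qbin (N ∸ 1) N′ *ₚ H N′))
    factor-out : ΣPS< (suc M) B ≈ oneMinusQ^ N *ₚ inner M F (N ∸ 1) (suc c ∷ r)
    factor-out = ≈-trans (ΣPS<-cong (suc M) (λ N′ _ → ≈-sym (shift-*ʳ ((N′ ℕ.+ suc c) C 2) (oneMinusQ^ N) (B′ N′))))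
                         (≈-sym (ΣPS<-*ˡ (suc M) (oneMinusQ^ N) (λ N′ → shift ((N′ ℕ.+ suc c) C 2) (B′ N′))))
      where B′ : ℕ → PS
            B′ N′ = qbin (N ∸ 1) N′ *ₚ H N′

  layer-raise : ∀ M w F c r →
    layer M w (suc c) (λ N → inner M F N (c ∷ r))
    ≈ layer M w c (λ N → inner M F N (suc c ∷ r)) -ₚ layer M w c (λ N → oneMinusQ^ N *ₚ inner M F (N ∸ 1) (suc c ∷ r))
  layer-raise M w F c r = ≈-trans (ΣPS<-cong (suc M) (λ N _ → term N)) (layer-- M w c K G)
    where
    K G : ℕ → PS
    K N = inner M F N (suc c ∷ r)
    G N = oneMinusQ^ N *ₚ inner M F (N ∸ 1) (suc c ∷ r)
    term : ∀ N → shift ((N ℕ.+ suc c) C 2) (w N *ₚ inner M F N (c ∷ r)) ≈ shift ((N ℕ.+ c) C 2) (w N *ₚ (K N -ₚ G N))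
    term N = begin
      shift ((N ℕ.+ suc c) C 2) (w N *ₚ I)
        ≡⟨ cong (λ e → shift e (w N *ₚ I)) (trans (cong (_C 2) (ℕP.+-suc N c)) (C2-suc (N ℕ.+ c))) ⟩
      shift ((N ℕ.+ c) C 2 ℕ.+ (N ℕ.+ c)) (w N *ₚ I)
        ≈⟨ shift-shift ((N ℕ.+ c) C 2) (N ℕ.+ c) (w N *ₚ I) ⟨
      shift ((N ℕ.+ c) C 2) (shift (N ℕ.+ c) (w N *ₚ I))
        ≈⟨ shift-cong ((N ℕ.+ c) C 2) (shift-*ʳ (N ℕ.+ c) (w N) I) ⟨
      shift ((N ℕ.+ c) C 2) (w N *ₚ shift (N ℕ.+ c) I)
        ≈⟨ shift-cong ((N ℕ.+ c) C 2) (*-cong (≈-refl {w N}) (shift-inner M F c r N)) ⟩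
      shift ((N ℕ.+ c) C 2) (w N *ₚ (K N -ₚ G N)) ∎
      where open ≈-Reasoning
            I = inner M F N (c ∷ r)

  record Absorbs (w w′ : ℕ → PS) (u : PS) : Set where
    constructor absorbs
    field absorb : ∀ N → w (suc N) *ₚ oneMinusQ^ (suc N) ≈ u *ₚ w′ N

  qbin-absorbs : ∀ P → Absorbs (qbin P) (qbin (P ∸ 1)) (oneMinusQ^ P)
  qbin-absorbs P = absorbs (qbin-suc-*-oneMinusQ^ P)

  invPoch-absorbs : Absorbs invPoch invPoch 1ₚ
  invPoch-absorbs = absorbs (λ N → ≈-trans (invPoch-*-oneMinusQ^ N) (≈-sym (*-identityˡ (invPoch N))))

  -- The N = 0 term vanishes, and the shift N ↦ N + 1 raises the exponent k to k + 1.
  layer-reindex : ∀ M {w w′ : ℕ → PS} {u : PS} k (X : ℕ → PS) → Absorbs w w′ u →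
    layer (suc M) w k (λ N → oneMinusQ^ N *ₚ X N) ≈ u *ₚ layer M w′ (suc k) (λ N → X (suc N))
  layer-reindex M {w} {w′} {u} k X (absorbs absorb) = begin
    ΣPS< (suc (suc M)) T                        ≈⟨ ΣPS<-head (suc M) T ⟩
    T 0 +ₚ ΣPS< (suc M) (λ N → T (suc N))       ≈⟨ +ₚ-vanishingˡ (ΣPS< (suc M) (λ N → T (suc N))) T0≈0 ⟩
    ΣPS< (suc M) (λ N → T (suc N))              ≈⟨ ΣPS<-cong (suc M) (λ N _ → step N) ⟩
    ΣPS< (suc M) (λ N → u *ₚ U N)               ≈⟨ ΣPS<-*ˡ (suc M) u U ⟨
    u *ₚ layer M w′ (suc k) (λ N → X (suc N))   ∎
    where
    open ≈-Reasoning
    T U : ℕ → PS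
    T N = shift ((N ℕ.+ k) C 2) (w N *ₚ (oneMinusQ^ N *ₚ X N))
    U N = shift ((N ℕ.+ suc k) C 2) (w′ N *ₚ X (suc N))
    T0≈0 : T 0 ≈ 0ₚ
    T0≈0 = shift-0ₚ (k C 2) (*-zeroʳ (w 0) _ (*-zeroˡ (oneMinusQ^ 0) (X 0) oneMinusQ^-0))
    step : ∀ N → T (suc N) ≈ u *ₚ U N
    step N = begin
      shift ((suc N ℕ.+ k) C 2) (w (suc N) *ₚ (oneMinusQ^ (suc N) *ₚ X (suc N)))
        ≡⟨ cong (λ e → shift (e C 2) (w (suc N) *ₚ (oneMinusQ^ (suc N) *ₚ X (suc N)))) (sym (ℕP.+-suc N k)) ⟩
      shift e (w (suc N) *ₚ (oneMinusQ^ (suc N) *ₚ X (suc N)))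
        ≈⟨ shift-cong e (*-assoc (w (suc N)) (oneMinusQ^ (suc N)) (X (suc N))) ⟨
      shift e ((w (suc N) *ₚ oneMinusQ^ (suc N)) *ₚ X (suc N))
        ≈⟨ shift-cong e (*-cong (absorb N) (≈-refl {X (suc N)})) ⟩
      shift e ((u *ₚ w′ N) *ₚ X (suc N))
        ≈⟨ shift-cong e (*-assoc u (w′ N) (X (suc N))) ⟩
      shift e (u *ₚ (w′ N *ₚ X (suc N)))
        ≈⟨ shift-*ʳ e u (w′ N *ₚ X (suc N)) ⟨
      u *ₚ U N ∎
      where e = (N ℕ.+ suc k) C 2

  layer-swap-head : ∀ M {w w′ : ℕ → PS} {u : PS} F c r → Absorbs w w′ u →
    layer (suc M) w (suc c) (λ N → inner (suc M) F N (c ∷ r))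
    ≈ layer (suc M) w c (λ N → inner (suc M) F N (suc c ∷ r)) -ₚ (u *ₚ layer M w′ (suc c) (λ N → inner M F N (suc c ∷ r)))
  layer-swap-head M {w} {w′} {u} F c r w-absorbs =
    ≈-trans (layer-raise (suc M) w F c r) (-ₚ-congˡ (layer (suc M) w c K) raised)
    where
    K : ℕ → PS
    K N = inner (suc M) F N (suc c ∷ r)
    raised : layer (suc M) w c (λ N → oneMinusQ^ N *ₚ K (N ∸ 1)) ≈ u *ₚ layer M w′ (suc c) (λ N → inner M F N (suc c ∷ r))
    raised = ≈-trans (layer-reindex M c (λ N → K (N ∸ 1)) w-absorbs)
                     (*-cong (≈-refl {u}) (layer-cong M w′ (suc c) (λ N N≤M → inner-truncate F (suc c ∷ r) N N≤M (ℕP.n≤1+n M))))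

  layer-swap-tail : ∀ M {w w′ : ℕ → PS} {u : PS} k (X Y Z : ℕ → PS) → Absorbs w w′ u →
    (∀ N → X N ≈ Y N -ₚ (oneMinusQ^ N *ₚ Z (N ∸ 1))) →
    layer (suc M) w k X ≈ layer (suc M) w k Y -ₚ (u *ₚ layer M w′ (suc k) Z)
  layer-swap-tail M {w} {w′} {u} k X Y Z w-absorbs X≈Y-Z n = begin
    layer (suc M) w k X n
      ≡⟨ layer-cong (suc M) w k (λ N _ → X≈Y-Z N) n ⟩
    layer (suc M) w k (λ N → Y N -ₚ (oneMinusQ^ N *ₚ Z (N ∸ 1))) n
      ≡⟨ layer-- (suc M) w k Y (λ N → oneMinusQ^ N *ₚ Z (N ∸ 1)) n ⟩
    layer (suc M) w k Y n - layer (suc M) w k (λ N → oneMinusQ^ N *ₚ Z (N ∸ 1)) n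
      ≡⟨ -ₚ-congˡ (layer (suc M) w k Y) (layer-reindex M k (λ N → Z (N ∸ 1)) w-absorbs) n ⟩
    layer (suc M) w k Y n - (u *ₚ layer M w′ (suc k) Z) n ∎
    where open ≡-Reasoning

  inner-swap : ∀ M F c r p P →
    inner (suc M) F P (p ++ suc c ∷ c ∷ r)
    ≈ inner (suc M) F P (p ++ c ∷ suc c ∷ r) -ₚ (oneMinusQ^ P *ₚ inner M F (P ∸ 1) (map suc p ++ suc c ∷ suc c ∷ r))
  inner-swap M F c r []      P = layer-swap-head M F c r (qbin-absorbs P)
  inner-swap M F c r (k ∷ p) P =
    layer-swap-tail M k (λ N → inner (suc M) F N (p ++ suc c ∷ c ∷ r)) (λ N → inner (suc M) F N (p ++ c ∷ suc c ∷ r))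
                    (λ N → inner M F N (map suc p ++ suc c ∷ suc c ∷ r)) (qbin-absorbs P) (inner-swap M F c r p)

  𝔖≤-swap : ∀ M F c r p →
    𝔖≤ (suc M) F (p ++ suc c ∷ c ∷ r) ≈ 𝔖≤ (suc M) F (p ++ c ∷ suc c ∷ r) -ₚ 𝔖≤ M F (map suc p ++ suc c ∷ suc c ∷ r)
  𝔖≤-swap M F c r []      =
    ≈-trans (layer-swap-head M F c r invPoch-absorbs)
            (-ₚ-congˡ (𝔖≤ (suc M) F (c ∷ suc c ∷ r)) (*-identityˡ (𝔖≤ M F (suc c ∷ suc c ∷ r))))
  𝔖≤-swap M F c r (k ∷ p) =
    ≈-trans (layer-swap-tail M k (λ N → inner (suc M) F N (p ++ suc c ∷ c ∷ r)) (λ N → inner (suc M) F N (p ++ c ∷ suc c ∷ r))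
                             (λ N → inner M F N (map suc p ++ suc c ∷ suc c ∷ r)) invPoch-absorbs (inner-swap M F c r p))
            (-ₚ-congˡ (𝔖≤ (suc M) F (k ∷ p ++ c ∷ suc c ∷ r)) (*-identityˡ (𝔖≤ M F (map suc (k ∷ p) ++ suc c ∷ suc c ∷ r))))

module Families where

  open PowerSeries
  open import Data.Nat as ℕ using (ℕ; zero; suc; _<_; _⊔_)
  import Data.Nat.Properties as ℕP
  open import Data.Integer using (ℤ; _+_; _-_)
  import Data.Integer.Properties as ℤP
  open import Data.Integer.Tactic.RingSolver using (solve-∀)
  open import Data.Product using (_,_; proj₁; proj₂)
  open import Level using (0ℓ)
  open import Relation.Binary.Bundles using (Setoid)
  open import Relation.Binary.PropositionalEquality
  import Relation.Binary.Reasoning.Setoid as SetoidReasoning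

  Fam : Set
  Fam = ℕ → PS

  ≐-setoid : Setoid 0ℓ 0ℓ
  ≐-setoid = record
    { Carrier       = Fam
    ; _≈_           = _≐_
    ; isEquivalence = record
      { refl  = λ n → 0 , λ _ _ → refl
      ; sym   = λ A≐B n → proj₁ (A≐B n) , λ M M₀≤M → sym (proj₂ (A≐B n) M M₀≤M)
      ; trans = λ A≐B B≐C n → proj₁ (A≐B n) ⊔ proj₁ (B≐C n) , λ M M₀≤M →
          trans (proj₂ (A≐B n) M (ℕP.≤-trans (ℕP.m≤m⊔n _ _) M₀≤M)) (proj₂ (B≐C n) M (ℕP.≤-trans (ℕP.m≤n⊔m _ _) M₀≤M))
      }
    }

  open Setoid ≐-setoid public using () renaming (refl to ≐-refl; sym to ≐-sym; trans to ≐-trans; reflexive to ≐-reflexive)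
  module ≐-Reasoning = SetoidReasoning ≐-setoid

  ≈⇒≐ : ∀ {A B : Fam} → (∀ M → A M ≈ B M) → A ≐ B
  ≈⇒≐ A≈B n = 0 , λ M _ → A≈B M n

  infixl 30 _⊕_ _⊖_
  _⊕_ _⊖_ : Fam → Fam → Fam
  (A ⊕ B) M = A M +ₚ B M
  (A ⊖ B) M = A M -ₚ B M

  lift₂-cong : ∀ (_∙_ : ℤ → ℤ → ℤ) {A A′ B B′ : Fam} → A ≐ A′ → B ≐ B′ →
               (λ M n → A M n ∙ B M n) ≐ (λ M n → A′ M n ∙ B′ M n)
  lift₂-cong _∙_ A≐A′ B≐B′ n = proj₁ (A≐A′ n) ⊔ proj₁ (B≐B′ n) , λ M M₀≤M →
    cong₂ _∙_ (proj₂ (A≐A′ n) M (ℕP.≤-trans (ℕP.m≤m⊔n _ _) M₀≤M)) (proj₂ (B≐B′ n) M (ℕP.≤-trans (ℕP.m≤n⊔m _ _) M₀≤M))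

  ⊕-cong : ∀ {A A′ B B′ : Fam} → A ≐ A′ → B ≐ B′ → A ⊕ B ≐ A′ ⊕ B′
  ⊕-cong = lift₂-cong _+_

  ⊖-cong : ∀ {A A′ B B′ : Fam} → A ≐ A′ → B ≐ B′ → A ⊖ B ≐ A′ ⊖ B′
  ⊖-cong = lift₂-cong _-_

  ⊖⇒⊕ : ∀ {A B C : Fam} → A ⊖ B ≐ C → A ≐ B ⊕ C
  ⊖⇒⊕ {A} {B} {C} A-B≐C = ≐-trans (≈⇒≐ (λ M n → regroup (A M n) (B M n))) (⊕-cong (≐-refl {B}) A-B≐C)
    where regroup : ∀ a b → a ≡ b + (a - b)
          regroup = solve-∀

  ⊖-via : ∀ (A B C : Fam) → A ⊖ C ≐ (A ⊖ B) ⊕ (B ⊖ C)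
  ⊖-via A B C = ≈⇒≐ (λ M n → regroup (A M n) (B M n) (C M n))
    where regroup : ∀ a b c → a - c ≡ (a - b) + (b - c)
          regroup = solve-∀

  ΣFam< : ℕ → (ℕ → Fam) → Fam
  ΣFam< n G M = ΣPS< n (λ j → G j M)

  ΣFam<-cong : ∀ n {G H : ℕ → Fam} → (∀ j → j < n → G j ≐ H j) → ΣFam< n G ≐ ΣFam< n H
  ΣFam<-cong zero    G≐H = ≐-refl
  ΣFam<-cong (suc n) G≐H = ⊕-cong (ΣFam<-cong n (λ j j<n → G≐H j (ℕP.m<n⇒m<1+n j<n))) (G≐H n ℕP.≤-refl)

  ΣFam<-head : ∀ n (G : ℕ → Fam) → ΣFam< (suc n) G ≐ G 0 ⊕ ΣFam< n (λ j → G (suc j))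
  ΣFam<-head n G = ≈⇒≐ (λ M → ΣPS<-head n (λ j → G j M))

  ΣFam<-1 : ∀ (G : ℕ → Fam) → ΣFam< 1 G ≐ G 0
  ΣFam<-1 G = ≈⇒≐ (λ M n → ℤP.+-identityˡ _)

  ΣFam<-⊕-⊖ : ∀ n (A B : ℕ → Fam) → ΣFam< n B ⊕ ΣFam< n (λ j → A j ⊖ B j) ≐ ΣFam< n A
  ΣFam<-⊕-⊖ n A B = ≈⇒≐ (λ M c → trans (cong (ΣFam< n B M c +_) (Σ<-- n (λ j → A j M c) (λ j → B j M c)))
                                        (cancel (ΣFam< n A M c) (ΣFam< n B M c)))
    where cancel : ∀ a b → b + (a - b) ≡ a
          cancel = solve-∀

module Replicate where

  open import Data.Nat as ℕ using (ℕ; zero; suc; _∸_; _≤_)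
  import Data.Nat.Properties as ℕP
  open import Data.List using (List; _∷_; _++_; replicate)
  open import Relation.Binary.PropositionalEquality

  replicate-++-∷ : ∀ n (x : ℕ) l → replicate n x ++ x ∷ l ≡ x ∷ replicate n x ++ l
  replicate-++-∷ zero    x l = refl
  replicate-++-∷ (suc n) x l = cong (x ∷_) (replicate-++-∷ n x l)

  replicate-++-∷∷ : ∀ n (x : ℕ) l → replicate n x ++ x ∷ x ∷ l ≡ x ∷ x ∷ replicate n x ++ l
  replicate-++-∷∷ n x l = trans (replicate-++-∷ n x (x ∷ l)) (cong (x ∷_) (replicate-++-∷ n x l))

  replicate-+ : ∀ a b (x : ℕ) l → replicate (a ℕ.+ b) x ++ l ≡ replicate a x ++ replicate b x ++ l
  replicate-+ zero    b x l = refl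
  replicate-+ (suc a) b x l = cong (x ∷_) (replicate-+ a b x l)

  replicate-∸-++-∷ : ∀ {j a} (x : ℕ) l → j ≤ a → replicate (a ∸ j) x ++ x ∷ l ≡ replicate (suc a ∸ j) x ++ l
  replicate-∸-++-∷ {j} {a} x l j≤a =
    trans (replicate-++-∷ (a ∸ j) x l) (cong (λ t → replicate t x ++ l) (sym (ℕP.+-∸-assoc 1 j≤a)))

  replicate-∸-self : ∀ a (x : ℕ) l → replicate (a ∸ a) x ++ l ≡ l
  replicate-∸-self a x l = cong (λ t → replicate t x ++ l) (ℕP.n∸n≡0 a)

module Expansions (F : ℕ → PS) where

  open PowerSeries
  open TruncatedSums
  open Families
  open Replicate
  open import Data.Nat as ℕ using (ℕ; zero; suc; _∸_; _≤_; s≤s)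
  import Data.Nat.Properties as ℕP
  open import Data.Integer using (_-_)
  open import Data.Integer.Tactic.RingSolver using (solve-∀)
  open import Data.List using (List; []; _∷_; _++_; map; replicate)
  import Data.List.Properties as ListP
  open import Data.Product using (_,_)
  open import Relation.Binary.PropositionalEquality

  𝕊 : List ℕ → Fam
  𝕊 w M = 𝔖≤ M F w

  𝕊-≡ : ∀ {w w′} → w ≡ w′ → 𝕊 w ≐ 𝕊 w′
  𝕊-≡ w≡w′ = ≐-reflexive (cong 𝕊 w≡w′)

  -- In 𝔖≤-swap at truncation M + 1 the last term is truncated at M; by 𝔖≤-stable that changes nothing below q^M.
  𝕊-swap : ∀ p c r → 𝕊 (p ++ c ∷ suc c ∷ r) ⊖ 𝕊 (p ++ suc c ∷ c ∷ r) ≐ 𝕊 (map suc p ++ suc c ∷ suc c ∷ r)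
  𝕊-swap p c r n = suc (suc n) , agree
    where
    X Y Z : List ℕ
    X = p ++ c ∷ suc c ∷ r
    Y = p ++ suc c ∷ c ∷ r
    Z = map suc p ++ suc c ∷ suc c ∷ r
    cancel : ∀ x z → x - (x - z) ≡ z
    cancel = solve-∀
    agree : ∀ M → suc (suc n) ≤ M → (𝕊 X ⊖ 𝕊 Y) M n ≡ 𝕊 Z M n
    agree (suc M) (s≤s n<M) = begin
      𝔖≤ (suc M) F X n - 𝔖≤ (suc M) F Y n
        ≡⟨ -ₚ-congˡ (𝔖≤ (suc M) F X) (𝔖≤-swap M F c r p) n ⟩
      𝔖≤ (suc M) F X n - (𝔖≤ (suc M) F X n - 𝔖≤ M F Z n)
        ≡⟨ cancel (𝔖≤ (suc M) F X n) (𝔖≤ M F Z n) ⟩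
      𝔖≤ M F Z n
        ≡⟨ 𝔖≤-stable M F Z n<M ⟨
      𝔖≤ (suc M) F Z n ∎
      where open ≡-Reasoning

  𝕊-pass-right : ∀ m y p k →
    𝕊 (p ++ m ∷ replicate (suc y) (suc m) ++ k) ⊖ 𝕊 (p ++ replicate (suc y) (suc m) ++ m ∷ k)
    ≐ ΣFam< (suc y) (λ t → 𝕊 (map suc p ++ replicate t (2 ℕ.+ m) ++ suc m ∷ suc m ∷ replicate (y ∸ t) (suc m) ++ k))
  𝕊-pass-right m zero    p k =
    ≐-trans (𝕊-swap p m k) (≐-sym (ΣFam<-1 (λ t → 𝕊 (map suc p ++ replicate t (2 ℕ.+ m) ++ suc m ∷ suc m ∷ replicate (0 ∸ t) (suc m) ++ k))))
  𝕊-pass-right m (suc y) p k = begin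
    𝕊 (p ++ m ∷ o ∷ l) ⊖ 𝕊 (p ++ o ∷ replicate (suc y) o ++ m ∷ k)
      ≈⟨ ⊖-via (𝕊 (p ++ m ∷ o ∷ l)) (𝕊 (p ++ o ∷ m ∷ l)) (𝕊 (p ++ o ∷ replicate (suc y) o ++ m ∷ k)) ⟩
    (𝕊 (p ++ m ∷ o ∷ l) ⊖ 𝕊 (p ++ o ∷ m ∷ l)) ⊕ (𝕊 (p ++ o ∷ m ∷ l) ⊖ 𝕊 (p ++ o ∷ replicate (suc y) o ++ m ∷ k))
      ≈⟨ ⊕-cong (𝕊-swap p m l) (⊖-cong (𝕊-≡ (snoc (m ∷ l))) (𝕊-≡ (snoc (replicate (suc y) o ++ m ∷ k)))) ⟩
    𝕊 (map suc p ++ o ∷ o ∷ l) ⊕ (𝕊 (p′ ++ m ∷ l) ⊖ 𝕊 (p′ ++ replicate (suc y) o ++ m ∷ k))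
      ≈⟨ ⊕-cong (≐-refl {𝕊 (map suc p ++ o ∷ o ∷ l)}) (𝕊-pass-right m y p′ k) ⟩
    𝕊 (map suc p ++ o ∷ o ∷ l) ⊕ ΣFam< (suc y) (λ t → 𝕊 (map suc p′ ++ tail-term t))
      ≈⟨ ⊕-cong (≐-refl {𝕊 (map suc p ++ o ∷ o ∷ l)}) (ΣFam<-cong (suc y) (λ t _ → 𝕊-≡ (map-snoc (tail-term t)))) ⟩
    G 0 ⊕ ΣFam< (suc y) (λ t → G (suc t))
      ≈⟨ ΣFam<-head (suc y) G ⟨
    ΣFam< (suc (suc y)) G ∎
    where
    open ≐-Reasoning
    o = suc m
    l = replicate (suc y) o ++ k
    p′ = p ++ o ∷ []
    tail-term : ℕ → List ℕ
    tail-term t = replicate t (suc o) ++ o ∷ o ∷ replicate (y ∸ t) o ++ k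
    G : ℕ → Fam
    G t = 𝕊 (map suc p ++ replicate t (suc o) ++ o ∷ o ∷ replicate (suc y ∸ t) o ++ k)
    snoc : ∀ l → p ++ o ∷ l ≡ p′ ++ l
    snoc l = sym (ListP.++-assoc p (o ∷ []) l)
    map-snoc : ∀ l → map suc p′ ++ l ≡ map suc p ++ suc o ∷ l
    map-snoc l = trans (cong (_++ l) (ListP.map-++ suc p (o ∷ []))) (ListP.++-assoc (map suc p) (suc o ∷ []) l)

  𝕊-pass-left : ∀ m a r →
    𝕊 (replicate a m ++ suc m ∷ r) ≐ ΣFam< (suc a) (λ j → 𝕊 (replicate (suc j) (suc m) ++ replicate (a ∸ j) m ++ r))
  𝕊-pass-left m zero    r = ≐-sym (ΣFam<-1 (λ j → 𝕊 (replicate (suc j) (suc m) ++ replicate (0 ∸ j) m ++ r)))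
  𝕊-pass-left m (suc a) r = begin
    𝕊 (m ∷ replicate a m ++ o ∷ r)
      ≈⟨ 𝕊-≡ (sym (replicate-++-∷ a m (o ∷ r))) ⟩
    𝕊 (replicate a m ++ m ∷ o ∷ r)
      ≈⟨ ⊖⇒⊕ (𝕊-swap (replicate a m) m r) ⟩
    𝕊 (replicate a m ++ o ∷ m ∷ r) ⊕ 𝕊 (map suc (replicate a m) ++ o ∷ o ∷ r)
      ≈⟨ ⊕-cong (𝕊-pass-left m a (m ∷ r)) (𝕊-≡ last) ⟩
    ΣFam< (suc a) (λ j → 𝕊 (replicate (suc j) o ++ replicate (a ∸ j) m ++ m ∷ r)) ⊕ G (suc a)
      ≈⟨ ⊕-cong (ΣFam<-cong (suc a) (λ j j<1+a → 𝕊-≡ (cong (replicate (suc j) o ++_)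
                                                         (replicate-∸-++-∷ m r (ℕP.≤-pred j<1+a)))))
                (≐-refl {G (suc a)}) ⟩
    ΣFam< (suc (suc a)) G ∎
    where
    open ≐-Reasoning
    o = suc m
    G : ℕ → Fam
    G j = 𝕊 (replicate (suc j) o ++ replicate (suc a ∸ j) m ++ r)
    last : map suc (replicate a m) ++ o ∷ o ∷ r ≡ replicate (suc (suc a)) o ++ replicate (a ∸ a) m ++ r
    last = trans (cong (_++ o ∷ o ∷ r) (ListP.map-replicate suc a m))
                 (trans (replicate-++-∷∷ a o r) (cong (λ l → o ∷ o ∷ replicate a o ++ l) (sym (replicate-∸-self a m r))))

  -- Part (i) of the theorem reads  δ m a i k ≐ δ m (i - 1) (a + 1) k.
  δ : ℕ → ℕ → ℕ → List ℕ → Fam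
  δ m x y k = 𝕊 (replicate x m ++ replicate y (suc m) ++ k) ⊖ 𝕊 (replicate (x ∸ 1) m ++ replicate y (suc m) ++ m ∷ k)

  -- Part (ii) of the theorem reads  ladder m a (i - 1) k ≐ ladder m (i - 1) a k.
  ladder : ℕ → ℕ → ℕ → List ℕ → Fam
  ladder m a n k = ΣFam< (suc n) (λ j → 𝕊 (replicate a m ++ replicate (suc j) (suc m) ++ replicate (n ∸ j) m ++ k))

  δ-as-ladder : ∀ m x y k →
    δ m (suc x) (suc (suc y)) k ≐ 𝕊 (replicate (3 ℕ.+ (x ℕ.+ y)) (suc m) ++ k) ⊕ ladder (suc m) x y (suc m ∷ suc m ∷ k)
  δ-as-ladder m x y k = begin
    𝕊 (m ∷ replicate x m ++ O ++ k) ⊖ 𝕊 (replicate x m ++ O ++ m ∷ k)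
      ≈⟨ ⊖-cong (𝕊-≡ (sym (replicate-++-∷ x m (O ++ k)))) (≐-refl {𝕊 (replicate x m ++ O ++ m ∷ k)}) ⟩
    𝕊 (replicate x m ++ m ∷ O ++ k) ⊖ 𝕊 (replicate x m ++ O ++ m ∷ k)
      ≈⟨ 𝕊-pass-right m (suc y) (replicate x m) k ⟩
    ΣFam< (suc (suc y)) G
      ≈⟨ ΣFam<-head (suc y) G ⟩
    G 0 ⊕ ΣFam< (suc y) (λ j → G (suc j))
      ≈⟨ ⊕-cong (𝕊-≡ head) (ΣFam<-cong (suc y) (λ j _ → 𝕊-≡ (rung j))) ⟩
    𝕊 (replicate (3 ℕ.+ (x ℕ.+ y)) o ++ k) ⊕ ladder o x y (o ∷ o ∷ k) ∎
    where
    open ≐-Reasoning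
    o = suc m
    O = replicate (suc (suc y)) o
    G : ℕ → Fam
    G t = 𝕊 (map suc (replicate x m) ++ replicate t (suc o) ++ o ∷ o ∷ replicate (suc y ∸ t) o ++ k)
    head : map suc (replicate x m) ++ o ∷ o ∷ o ∷ replicate y o ++ k ≡ replicate (3 ℕ.+ (x ℕ.+ y)) o ++ k
    head = trans (cong (_++ o ∷ o ∷ o ∷ replicate y o ++ k) (ListP.map-replicate suc x m))
                 (trans (sym (replicate-+ x (3 ℕ.+ y) o k))
                        (cong (λ t → replicate t o ++ k) (trans (ℕP.+-comm x (3 ℕ.+ y)) (cong (3 ℕ.+_) (ℕP.+-comm y x)))))
    rung : ∀ j → map suc (replicate x m) ++ replicate (suc j) (suc o) ++ o ∷ o ∷ replicate (y ∸ j) o ++ k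
               ≡ replicate x o ++ replicate (suc j) (suc o) ++ replicate (y ∸ j) o ++ o ∷ o ∷ k
    rung j = cong₂ _++_ (ListP.map-replicate suc x m)
                        (cong (replicate (suc j) (suc o) ++_) (sym (replicate-++-∷∷ (y ∸ j) o k)))

  δ-symmetric-if : ∀ m x y k → (∀ k → ladder (suc m) x y k ≐ ladder (suc m) y x k) →
    δ m (suc x) (suc (suc y)) k ≐ δ m (suc y) (suc (suc x)) k
  δ-symmetric-if m x y k ladder-sym =
    ≐-trans (δ-as-ladder m x y k)
    (≐-trans (⊕-cong (𝕊-≡ (cong (λ t → replicate (3 ℕ.+ t) (suc m) ++ k) (ℕP.+-comm x y)))
                     (ladder-sym (suc m ∷ suc m ∷ k)))
             (≐-sym (δ-as-ladder m y x k)))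

  𝕊-δ-expansion : ∀ m n → (∀ b k → δ m (suc b) (suc (suc n)) k ≐ δ m (suc n) (suc (suc b)) k) →
    ∀ a k → 𝕊 (replicate a m ++ replicate (suc (suc n)) (suc m) ++ k)
            ≐ ΣFam< (suc a) (λ j → δ m (suc n) (suc j) (replicate (a ∸ j) m ++ k))
  𝕊-δ-expansion m n δ-sym zero k = begin
    𝕊 (o ∷ o ∷ replicate n o ++ k)
      ≈⟨ 𝕊-≡ (trans (cong (_++ o ∷ o ∷ k) (ListP.map-replicate suc n m)) (replicate-++-∷∷ n o k)) ⟨
    𝕊 (map suc (replicate n m) ++ o ∷ o ∷ k)
      ≈⟨ 𝕊-swap (replicate n m) m k ⟨
    𝕊 (replicate n m ++ m ∷ o ∷ k) ⊖ 𝕊 (replicate n m ++ o ∷ m ∷ k)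
      ≈⟨ ⊖-cong (𝕊-≡ (replicate-++-∷ n m (o ∷ k))) (≐-refl {𝕊 (replicate n m ++ o ∷ m ∷ k)}) ⟩
    δ m (suc n) 1 k
      ≈⟨ ΣFam<-1 (λ j → δ m (suc n) (suc j) (replicate (0 ∸ j) m ++ k)) ⟨
    ΣFam< 1 (λ j → δ m (suc n) (suc j) (replicate (0 ∸ j) m ++ k)) ∎
    where open ≐-Reasoning
          o = suc m
  𝕊-δ-expansion m n δ-sym (suc a) k = begin
    𝕊 (replicate (suc a) m ++ O ++ k)
      ≈⟨ ⊖⇒⊕ {𝕊 (replicate (suc a) m ++ O ++ k)} {𝕊 (replicate a m ++ O ++ m ∷ k)} {δ m (suc a) (suc (suc n)) k} ≐-refl ⟩
    𝕊 (replicate a m ++ O ++ m ∷ k) ⊕ δ m (suc a) (suc (suc n)) k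
      ≈⟨ ⊕-cong (𝕊-δ-expansion m n δ-sym a (m ∷ k)) (δ-sym a k) ⟩
    ΣFam< (suc a) (λ j → δ m (suc n) (suc j) (replicate (a ∸ j) m ++ m ∷ k)) ⊕ δ m (suc n) (suc (suc a)) k
      ≈⟨ ⊕-cong (ΣFam<-cong (suc a) (λ j j<1+a → ≐-reflexive (cong (δ m (suc n) (suc j))
                                                     (replicate-∸-++-∷ m k (ℕP.≤-pred j<1+a)))))
                (≐-reflexive (cong (δ m (suc n) (suc (suc a))) (sym (replicate-∸-self a m k)))) ⟩
    ΣFam< (suc (suc a)) (λ j → δ m (suc n) (suc j) (replicate (suc a ∸ j) m ++ k)) ∎
    where open ≐-Reasoning
          O = replicate (suc (suc n)) (suc m)

  ladder-suc : ∀ m a n k →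
    ladder m a (suc n) k ≐ ladder m a n (m ∷ k) ⊕ 𝕊 (replicate a m ++ replicate (suc (suc n)) (suc m) ++ k)
  ladder-suc m a n k =
    ⊕-cong (ΣFam<-cong (suc n) (λ j j<1+n → 𝕊-≡ (cong (λ l → replicate a m ++ replicate (suc j) (suc m) ++ l)
                                                     (sym (replicate-∸-++-∷ m k (ℕP.≤-pred j<1+n))))))
           (𝕊-≡ (cong (λ l → replicate a m ++ replicate (suc (suc n)) (suc m) ++ l) (replicate-∸-self n m k)))

  ladder-symmetric : ∀ n m a k → ladder m a n k ≐ ladder m n a k
  ladder-symmetric zero    m a k =
    ≐-trans (ΣFam<-1 (λ j → 𝕊 (replicate a m ++ replicate (suc j) (suc m) ++ replicate (0 ∸ j) m ++ k))) (𝕊-pass-left m a k)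
  ladder-symmetric (suc n) m a k = begin
    ladder m a (suc n) k
      ≈⟨ ladder-suc m a n k ⟩
    ladder m a n (m ∷ k) ⊕ 𝕊 (replicate a m ++ replicate (suc (suc n)) o ++ k)
      ≈⟨ ⊕-cong (ladder-symmetric n m a (m ∷ k)) (𝕊-δ-expansion m n δ-sym a k) ⟩
    ΣFam< (suc a) lower ⊕ ΣFam< (suc a) (λ j → δ m (suc n) (suc j) (replicate (a ∸ j) m ++ k))
      ≈⟨ ⊕-cong (≐-refl {ΣFam< (suc a) lower}) (ΣFam<-cong (suc a) (λ j _ → ⊖-cong (≐-refl {upper j}) (𝕊-≡ (reorder j)))) ⟩
    ΣFam< (suc a) lower ⊕ ΣFam< (suc a) (λ j → upper j ⊖ lower j)
      ≈⟨ ΣFam<-⊕-⊖ (suc a) upper lower ⟩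
    ladder m (suc n) a k ∎
    where
    open ≐-Reasoning
    o = suc m
    -- The symmetry of δ needed by 𝕊-δ-expansion is the induction hypothesis one level up.
    δ-sym : ∀ b k → δ m (suc b) (suc (suc n)) k ≐ δ m (suc n) (suc (suc b)) k
    δ-sym b k = δ-symmetric-if m b n k (ladder-symmetric n (suc m) b)
    upper lower : ℕ → Fam
    upper j = 𝕊 (replicate (suc n) m ++ replicate (suc j) o ++ replicate (a ∸ j) m ++ k)
    lower j = 𝕊 (replicate n m ++ replicate (suc j) o ++ replicate (a ∸ j) m ++ m ∷ k)
    reorder : ∀ j → replicate n m ++ replicate (suc j) o ++ m ∷ replicate (a ∸ j) m ++ k
                    ≡ replicate n m ++ replicate (suc j) o ++ replicate (a ∸ j) m ++ m ∷ k
    reorder j = cong (λ l → replicate n m ++ replicate (suc j) o ++ l) (sym (replicate-++-∷ (a ∸ j) m k))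

  δ-symmetric : ∀ m x y k → δ m (suc x) (suc (suc y)) k ≐ δ m (suc y) (suc (suc x)) k
  δ-symmetric m x y k = δ-symmetric-if m x y k (ladder-symmetric y (suc m) x)

  ladder-+1 : ∀ m a n k →
    ladder m a n k ≐ ΣFam< (suc n) (λ j → 𝕊 (replicate a m ++ replicate (j ℕ.+ 1) (suc m) ++ replicate (n ∸ j) m ++ k))
  ladder-+1 m a n k = ΣFam<-cong (suc n) (λ j _ →
    𝕊-≡ (cong (λ t → replicate a m ++ replicate t (suc m) ++ replicate (n ∸ j) m ++ k) (ℕP.+-comm 1 j)))

open import Data.Nat using (zero; suc; _≤_; _∸_; _+_; s≤s)
import Data.Nat.Properties as ℕP
open import Data.List using (List; _∷_; replicate; _++_)
open import Data.Product using (_×_; _,_)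
open import Relation.Binary.PropositionalEquality using (subst)

lemma5p11 : (F : ℕ → PS) (k : List ℕ) →
    (∀ (a i m : ℕ) → 2 ≤ i → i ≤ a →
      (λ M → 𝔖≤ M F (replicate a m ++ replicate i (suc m) ++ k)
             -ₚ 𝔖≤ M F (replicate (a ∸ 1) m ++ replicate i (suc m) ++ m ∷ k))
      ≐
      (λ M → 𝔖≤ M F (replicate (i ∸ 1) m ++ replicate (a + 1) (suc m) ++ k)
             -ₚ 𝔖≤ M F (replicate (i ∸ 2) m ++ replicate (a + 1) (suc m) ++ m ∷ k)))
    ×
    (∀ (a i m : ℕ) → 1 ≤ i → i ≤ a →
      (λ M → ΣPS< i (λ j → 𝔖≤ M F (replicate a m ++ replicate (j + 1) (suc m) ++ replicate (i ∸ 1 ∸ j) m ++ k)))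
      ≐
      (λ M → ΣPS< (a + 1) (λ j → 𝔖≤ M F (replicate (i ∸ 1) m ++ replicate (j + 1) (suc m) ++ replicate (a ∸ j) m ++ k))))
lemma5p11 F k = (λ where
    (suc a) (suc (suc i)) m _ (s≤s _) →
      subst (λ b → δ m (suc a) (suc (suc i)) k ≐ δ m (suc i) b k) (ℕP.+-comm 1 (suc a)) (δ-symmetric m a i k)
    zero (suc (suc _)) _ _ ()
    _ zero _ () _
    _ (suc zero) _ (s≤s ()) _)
  , (λ where
    a (suc n) m _ _ →
      ≐-trans (≐-sym (ladder-+1 m a n k))
              (≐-trans (ladder-symmetric n m a k)
                       (subst (λ b → ladder m n a k ≐ ΣFam< b (λ j → 𝕊 (replicate n m ++ replicate (j + 1) (suc m) ++ replicate (a ∸ j) m ++ k)))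
                              (ℕP.+-comm 1 a) (ladder-+1 m n a k)))
    _ zero _ () _)
  where open Families; open Expansions F
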